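{- Let $(R(n))_{n\ge1}$ be a sequence of integers satisfying $R(n+d)=a_{d-1}R(n+d-1)+\cdots+a_0R(n)+b$ for all $n\ge1$, where $d\ge1$ and $a_0,\ldots,a_{d-1},b$ are integers with $a_0\ne0$. Let $q\ge2$ be an integer. Then there exist integers $s,L\in[1,q^d]$ such that the sequence $(R(n)\bmod q)_{n\ge s}$ is purely $L$-periodic. Moreover, $s$ can be chosen so that in addition: (a) if $a_0$ and $q$ are coprime, then $s=1$; (b) if $q$ is a prime number, then $s\le |a_0|^d$.
   Context: For integers $N$ and $q\ge1$, $N\bmod q$ denotes the unique $r\in\{0,1,\ldots,q-1\}$ with $N\equiv r \pmod q$. A sequence $(t(n))_{n\ge n_0}$ is purely $L$-periodic if $t(n)=t(n+L)$ for every integer $n\ge n_0$. -}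

module Defs where

open import Data.Nat using (ℕ; zero; suc)
open import Data.Integer using (ℤ; 0ℤ; _+_)
open import Data.Integer.DivMod using (_%ℕ_)

-- N mod q : the unique r ∈ {0,…,q-1} with N ≡ r (mod q).
-- (For q = 0 we return 0 arbitrarily; the statement only uses q ≥ 2.)
_modℕ_ : ℤ → ℕ → ℕ
N modℕ zero    = 0
N modℕ (suc q) = N %ℕ suc q

sumBelow : ℕ → (ℕ → ℤ) → ℤ
sumBelow zero    f = 0ℤ
sumBelow (suc k) f = sumBelow k f + f k

-- Reduce the recurrence modulo q. A window of d consecutive residues determines the next
-- residue, so two equal windows start a period; among the q ^ d + 1 windows starting at
-- 1, …, q ^ d + 1 two coincide by pigeonhole. When a₀ is invertible modulo q the
-- recurrence can also be run backwards, so the period reaches back to n = 1. Otherwise a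
-- prime q divides a₀, whence q ^ d ≤ ∣a₀∣ ^ d.
module Submission where

open import Defs
open import Data.Nat using (ℕ; _≤_; _^_)
open import Data.Nat.Coprimality using (Coprime)
open import Data.Nat.Primality using (Prime)
open import Data.Integer using (ℤ; _+_; _*_; 0ℤ; ∣_∣)
open import Data.Product using (Σ; _×_)
open import Relation.Binary.PropositionalEquality using (_≡_; _≢_)

open import Data.Nat as ℕ using (zero; suc; pred; _∸_; _<_; _⊔_; NonZero; z≤n; s<s)
open import Data.Nat.Properties
  using (≤-refl; ≤-trans; <-trans; ≤-<-trans; <⇒≤; ≤-pred; n<1+n; +-suc; +-assoc;
         +-identityʳ; m∸n≤m; m∸n+n≡m; m≤n+m; m≤m+n; m+[n∸m]≡n; m<n⇒0<n∸m; m≤n⇒m<n∨m≡n;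
         m<n⇒m<1+n; suc-pred; ⊔-lub; m^n>0; ^-monoˡ-≤)
import Data.Nat.Divisibility as ℕ∣
open import Data.Nat.DivMod using (m<n⇒m%n≡m)
open import Data.Nat.Coprimality using (coprime?; coprime-divisor)
  renaming (sym to coprime-sym)
open import Data.Nat.Primality using (prime⇒irreducible)
open import Data.Integer using (+_; _-_)
open import Data.Integer.Properties as ℤ
  using (+-injective; +-inverseʳ; +-minus-telescope; ∣i-j∣≡∣j-i∣; [+m]-[+n]≡m⊖n; ∣m⊝n∣≤m⊔n;
         i-j≡0⇒i≡j; ∣i∣≡0⇒i≡0; abs-*)
open import Data.Integer.DivMod using (_%ℕ_; _/ℕ_; a≡a%ℕn+[a/ℕn]*n; n%ℕd<d)
open import Data.Integer.Divisibility.Signed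
  using (_∣_; divides; ∣ᵤ⇒∣; ∣⇒∣ᵤ; ∣m∣n⇒∣m+n; ∣m∣n⇒∣m-n; ∣n⇒∣m*n)
open import Data.Integer.Tactic.RingSolver using (solve-∀)
open import Data.Fin using (Fin; toℕ; fromℕ<; funToFin; finToFun)
open import Data.Fin.Properties using (toℕ<n; toℕ-fromℕ<; finToFun-funToFin; pigeonhole)
open import Data.Product using (_,_)
open import Data.Sum using (inj₁; inj₂)
open import Data.Empty using (⊥-elim)
open import Relation.Nullary using (¬_; yes; no; contradiction)
open import Relation.Binary.PropositionalEquality
  using (refl; sym; trans; cong; subst; subst₂; module ≡-Reasoning)
open import Function using (_∘_; case_of_)

private variable
  x y u v : ℤ
  m n p q : ℕ

infix 4 _≡_mod_

data _≡_mod_ (x y : ℤ) (q : ℕ) : Set where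
  divides-difference : + q ∣ x - y → x ≡ y mod q

≡-mod-refl : x ≡ x mod q
≡-mod-refl {x} {q} = divides-difference (subst (+ q ∣_) (sym (+-inverseʳ x)) (∣ᵤ⇒∣ (q ℕ∣.∣0)))

≡-mod-sym : x ≡ y mod q → y ≡ x mod q
≡-mod-sym {x} {y} {q} (divides-difference q∣x-y) =
  divides-difference (∣ᵤ⇒∣ (subst (q ℕ∣.∣_) (∣i-j∣≡∣j-i∣ x y) (∣⇒∣ᵤ q∣x-y)))

≡-mod-trans : x ≡ y mod q → y ≡ u mod q → x ≡ u mod q
≡-mod-trans {x} {y} {q} {u} (divides-difference q∣x-y) (divides-difference q∣y-u) =
  divides-difference (subst (+ q ∣_) (+-minus-telescope x y u) (∣m∣n⇒∣m+n q∣x-y q∣y-u))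

≡-mod-+-cong : x ≡ y mod q → u ≡ v mod q → x + u ≡ y + v mod q
≡-mod-+-cong {x} {y} {q} {u} {v} (divides-difference q∣x-y) (divides-difference q∣u-v) =
  divides-difference (subst (+ q ∣_) (sym (rearrange x y u v)) (∣m∣n⇒∣m+n q∣x-y q∣u-v))
  where
  rearrange : ∀ x y u v → (x + u) - (y + v) ≡ (x - y) + (u - v)
  rearrange = solve-∀

≡-mod-+-cancelʳ : x + u ≡ y + v mod q → u ≡ v mod q → x ≡ y mod q
≡-mod-+-cancelʳ {x} {u} {y} {v} {q} (divides-difference q∣sum) (divides-difference q∣u-v) =
  divides-difference (subst (+ q ∣_) (sym (rearrange x y u v)) (∣m∣n⇒∣m-n q∣sum q∣u-v))
  where
  rearrange : ∀ x y u v → x - y ≡ ((x + u) - (y + v)) - (u - v)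
  rearrange = solve-∀

*-distribˡ-minus : ∀ c x y → c * (x - y) ≡ c * x - c * y
*-distribˡ-minus = solve-∀

≡-mod-*-congˡ : ∀ c → x ≡ y mod q → c * x ≡ c * y mod q
≡-mod-*-congˡ {x} {y} {q} c (divides-difference q∣x-y) =
  divides-difference (subst (+ q ∣_) (*-distribˡ-minus c x y) (∣n⇒∣m*n c q∣x-y))

≡-mod-*-cancelˡ : ∀ c → Coprime ∣ c ∣ q → c * x ≡ c * y mod q → x ≡ y mod q
≡-mod-*-cancelˡ {q} {x} {y} c c⊥q (divides-difference q∣cx-cy) =
  divides-difference (∣ᵤ⇒∣ (coprime-divisor (coprime-sym c⊥q) q∣∣c∣*∣x-y∣))
  where
  q∣∣c∣*∣x-y∣ : q ℕ∣.∣ ∣ c ∣ ℕ.* ∣ x - y ∣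
  q∣∣c∣*∣x-y∣ = subst (q ℕ∣.∣_) (abs-* c (x - y))
    (∣⇒∣ᵤ (subst (+ q ∣_) (sym (*-distribˡ-minus c x y)) q∣cx-cy))

sumBelow-cong-mod : ∀ k {f g : ℕ → ℤ} → (∀ i → i < k → f i ≡ g i mod q) →
                    sumBelow k f ≡ sumBelow k g mod q
sumBelow-cong-mod zero    f≡g = ≡-mod-refl
sumBelow-cong-mod (suc k) f≡g =
  ≡-mod-+-cong (sumBelow-cong-mod k (λ i i<k → f≡g i (m<n⇒m<1+n i<k))) (f≡g k (n<1+n k))

sumBelow-sucˡ : ∀ k (f : ℕ → ℤ) → sumBelow (suc k) f ≡ f 0 + sumBelow k (f ∘ suc)
sumBelow-sucˡ zero    f = trans (ℤ.+-identityˡ (f 0)) (sym (ℤ.+-identityʳ (f 0)))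
sumBelow-sucˡ (suc k) f = trans (cong (_+ f (suc k)) (sumBelow-sucˡ k f))
                                (ℤ.+-assoc (f 0) (sumBelow k (f ∘ suc)) (f (suc k)))

sumBelow-head-cancel : ∀ k .{{_ : NonZero k}} {f g : ℕ → ℤ} →
                       (∀ i → 1 ≤ i → i < k → f i ≡ g i mod q) →
                       sumBelow k f ≡ sumBelow k g mod q → f 0 ≡ g 0 mod q
sumBelow-head-cancel (suc k) {f} {g} tail≡ sum≡ = ≡-mod-+-cancelʳ
  (subst₂ (λ s t → s ≡ t mod _) (sumBelow-sucˡ k f) (sumBelow-sucˡ k g) sum≡)
  (sumBelow-cong-mod k (λ i i<k → tail≡ (suc i) (s<s z≤n) (s<s i<k)))

module _ .{{_ : NonZero q}} where

  ≡-mod-%ℕ : ∀ x → x ≡ + (x %ℕ q) mod q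
  ≡-mod-%ℕ x = divides-difference (divides (x /ℕ q) (begin
    x - + (x %ℕ q)                             ≡⟨ cong (_- + (x %ℕ q)) (a≡a%ℕn+[a/ℕn]*n x q) ⟩
    (+ (x %ℕ q) + x /ℕ q * + q) - + (x %ℕ q)   ≡⟨ cancel (+ (x %ℕ q)) (x /ℕ q * + q) ⟩
    x /ℕ q * + q                               ∎))
    where
    open ≡-Reasoning
    cancel : ∀ r t → (r + t) - r ≡ t
    cancel = solve-∀

  residue-unique : ∀ {r s} → r < q → s < q → + r ≡ + s mod q → r ≡ s
  residue-unique {r} {s} r<q s<q (divides-difference q∣r-s) =
    +-injective (i-j≡0⇒i≡j (+ r) (+ s) (∣i∣≡0⇒i≡0 ∣r-s∣≡0))
    where
    ∣r-s∣<q : ∣ + r - + s ∣ < q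
    ∣r-s∣<q = ≤-<-trans (subst (_≤ r ⊔ s) (cong ∣_∣ (sym ([+m]-[+n]≡m⊖n r s))) (∣m⊝n∣≤m⊔n r s))
                        (⊔-lub r<q s<q)
    ∣r-s∣≡0 : ∣ + r - + s ∣ ≡ 0
    ∣r-s∣≡0 = trans (sym (m<n⇒m%n≡m ∣r-s∣<q)) (ℕ∣.n∣m⇒m%n≡0 _ q (∣⇒∣ᵤ q∣r-s))

  %ℕ-≡⇒≡-mod : x %ℕ q ≡ y %ℕ q → x ≡ y mod q
  %ℕ-≡⇒≡-mod {x} {y} x%q≡y%q = ≡-mod-trans (≡-mod-%ℕ x)
    (subst (λ r → + r ≡ y mod q) (sym x%q≡y%q) (≡-mod-sym (≡-mod-%ℕ y)))

  ≡-mod⇒%ℕ-≡ : x ≡ y mod q → x %ℕ q ≡ y %ℕ q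
  ≡-mod⇒%ℕ-≡ {x} {y} x≡y = residue-unique (n%ℕd<d x q) (n%ℕd<d y q)
    (≡-mod-trans (≡-mod-sym (≡-mod-%ℕ x)) (≡-mod-trans x≡y (≡-mod-%ℕ y)))

funToFin-injective : ∀ (f g : Fin m → Fin n) → funToFin f ≡ funToFin g → ∀ i → f i ≡ g i
funToFin-injective f g eq i = begin
  f i                       ≡⟨ finToFun-funToFin f i ⟨
  finToFun (funToFin f) i   ≡⟨ cong (λ k → finToFun k i) eq ⟩
  finToFun (funToFin g) i   ≡⟨ finToFun-funToFin g i ⟩
  g i                       ∎
  where open ≡-Reasoning

¬coprime⇒prime∣ : Prime p → ¬ Coprime n p → p ℕ∣.∣ n
¬coprime⇒prime∣ {p} {n} p-prime ¬n⊥p with p ℕ∣.∣? n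
... | yes p∣n = p∣n
... | no  p∤n = ⊥-elim (¬n⊥p n⊥p)
  where
  n⊥p : Coprime n p
  n⊥p {k} (k∣n , k∣p) with prime⇒irreducible p-prime k∣p
  ... | inj₁ k≡1 = k≡1
  ... | inj₂ refl = contradiction k∣n p∤n

module LinearRecurrence
  (d : ℕ) (a : ℕ → ℤ) (b : ℤ) (R : ℕ → ℤ)
  (rec : ∀ n → 1 ≤ n → R (n ℕ.+ d) ≡ sumBelow d (λ i → a i * R (n ℕ.+ i)) + b)
  (q : ℕ)
  where

  WindowsAgree : ℕ → ℕ → Set
  WindowsAgree n m = ∀ i → i < d → R (n ℕ.+ i) ≡ R (m ℕ.+ i) mod q

  private
    R-subst : ∀ {n n′ m m′} → n ≡ n′ → m ≡ m′ → R n ≡ R m mod q → R n′ ≡ R m′ mod q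
    R-subst refl refl R≡ = R≡

    last-index : ∀ n {i} → suc i ≡ d → n ℕ.+ d ≡ suc n ℕ.+ i
    last-index n {i} 1+i≡d = trans (cong (n ℕ.+_) (sym 1+i≡d)) (+-suc n i)

  next-term-agrees : 1 ≤ n → 1 ≤ m → WindowsAgree n m → R (n ℕ.+ d) ≡ R (m ℕ.+ d) mod q
  next-term-agrees {n} {m} 1≤n 1≤m window≡ =
    subst₂ (λ s t → s ≡ t mod q) (sym (rec n 1≤n)) (sym (rec m 1≤m))
      (≡-mod-+-cong (sumBelow-cong-mod d (λ i i<d → ≡-mod-*-congˡ (a i) (window≡ i i<d)))
                    ≡-mod-refl)

  WindowsAgree-suc : 1 ≤ n → 1 ≤ m → WindowsAgree n m → WindowsAgree (suc n) (suc m)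
  WindowsAgree-suc {n} {m} 1≤n 1≤m window≡ i i<d with m≤n⇒m<n∨m≡n i<d
  ... | inj₁ 1+i<d = R-subst (+-suc n i) (+-suc m i) (window≡ (suc i) 1+i<d)
  ... | inj₂ 1+i≡d =
    R-subst (last-index n 1+i≡d) (last-index m 1+i≡d) (next-term-agrees 1≤n 1≤m window≡)

  WindowsAgree-+ : 1 ≤ n → 1 ≤ m → WindowsAgree n m → ∀ k → WindowsAgree (k ℕ.+ n) (k ℕ.+ m)
  WindowsAgree-+ 1≤n 1≤m window≡ zero    = window≡
  WindowsAgree-+ {n} {m} 1≤n 1≤m window≡ (suc k) = WindowsAgree-suc
    (≤-trans 1≤n (m≤n+m n k)) (≤-trans 1≤m (m≤n+m m k)) (WindowsAgree-+ 1≤n 1≤m window≡ k)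

  WindowsAgree⇒periodic : ∀ {s L} .{{_ : NonZero d}} → 1 ≤ s → WindowsAgree s (s ℕ.+ L) →
                          ∀ n → s ≤ n → R n ≡ R (n ℕ.+ L) mod q
  WindowsAgree⇒periodic {s} {L} 1≤s window≡ n s≤n =
    R-subst from-start from-start+L
      (WindowsAgree-+ 1≤s (≤-trans 1≤s (m≤m+n s L)) window≡ k 0 (ℕ.>-nonZero⁻¹ d))
    where
    k = n ∸ s
    from-start : k ℕ.+ s ℕ.+ 0 ≡ n
    from-start = trans (+-identityʳ (k ℕ.+ s)) (m∸n+n≡m s≤n)
    from-start+L : k ℕ.+ (s ℕ.+ L) ℕ.+ 0 ≡ n ℕ.+ L
    from-start+L =
      trans (+-identityʳ _) (trans (sym (+-assoc k s L)) (cong (ℕ._+ L) (m∸n+n≡m s≤n)))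

  WindowsAgree-pred : .{{_ : NonZero d}} → Coprime ∣ a 0 ∣ q → 1 ≤ n → 1 ≤ m →
                      WindowsAgree (suc n) (suc m) → WindowsAgree n m
  WindowsAgree-pred {n} {m} a₀⊥q 1≤n 1≤m window≡ zero _ =
    ≡-mod-*-cancelˡ (a 0) a₀⊥q (sumBelow-head-cancel d tail≡ sum≡)
    where
    tail≡ : ∀ i → 1 ≤ i → i < d → a i * R (n ℕ.+ i) ≡ a i * R (m ℕ.+ i) mod q
    tail≡ (suc i) _ 1+i<d = ≡-mod-*-congˡ (a (suc i))
      (R-subst (sym (+-suc n i)) (sym (+-suc m i)) (window≡ i (<-trans (n<1+n i) 1+i<d)))
    last≡ : R (n ℕ.+ d) ≡ R (m ℕ.+ d) mod q
    last≡ = R-subst (sym (last-index n (suc-pred d))) (sym (last-index m (suc-pred d)))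
              (window≡ (pred d) (subst (pred d <_) (suc-pred d) (n<1+n (pred d))))
    sum≡ : sumBelow d (λ i → a i * R (n ℕ.+ i)) ≡ sumBelow d (λ i → a i * R (m ℕ.+ i)) mod q
    sum≡ = ≡-mod-+-cancelʳ (subst₂ (λ s t → s ≡ t mod q) (rec n 1≤n) (rec m 1≤m) last≡) ≡-mod-refl
  WindowsAgree-pred {n} {m} a₀⊥q 1≤n 1≤m window≡ (suc i) 1+i<d =
    R-subst (sym (+-suc n i)) (sym (+-suc m i)) (window≡ i (<-trans (n<1+n i) 1+i<d))

  WindowsAgree-from-1 : .{{_ : NonZero d}} → Coprime ∣ a 0 ∣ q → ∀ {s L} → 1 ≤ s →
                        WindowsAgree s (s ℕ.+ L) → WindowsAgree 1 (1 ℕ.+ L)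
  WindowsAgree-from-1 a₀⊥q {suc zero}    _ window≡ = window≡
  WindowsAgree-from-1 a₀⊥q {suc (suc s)} _ window≡ =
    WindowsAgree-from-1 a₀⊥q (s<s z≤n) (WindowsAgree-pred a₀⊥q (s<s z≤n) (s<s z≤n) window≡)

  module _ .{{_ : NonZero q}} where

    residueWindow : ℕ → Fin d → Fin q
    residueWindow n i = fromℕ< (n%ℕd<d (R (n ℕ.+ toℕ i)) q)

    residueWindow-≡⇒WindowsAgree : funToFin (residueWindow n) ≡ funToFin (residueWindow m) →
                                   WindowsAgree n m
    residueWindow-≡⇒WindowsAgree {n} {m} code≡ i i<d = %ℕ-≡⇒≡-mod (begin
      R (n ℕ.+ i) %ℕ q         ≡⟨ residue n ⟨
      toℕ (residueWindow n j)  ≡⟨ cong toℕ (funToFin-injective _ _ code≡ j) ⟩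
      toℕ (residueWindow m j)  ≡⟨ residue m ⟩
      R (m ℕ.+ i) %ℕ q         ∎)
      where
      open ≡-Reasoning
      j = fromℕ< i<d
      residue : ∀ n → toℕ (residueWindow n j) ≡ R (n ℕ.+ i) %ℕ q
      residue n = trans (toℕ-fromℕ< _) (cong (λ k → R (n ℕ.+ k) %ℕ q) (toℕ-fromℕ< i<d))

    repeated-window : Σ ℕ λ s → Σ ℕ λ L →
                      (1 ≤ s × s ≤ q ^ d) × (1 ≤ L × L ≤ q ^ d) × WindowsAgree s (s ℕ.+ L)
    repeated-window =
      let i , j , i<j , code≡ =
            pigeonhole (n<1+n (q ^ d)) (λ k → funToFin (residueWindow (suc (toℕ k))))
          j≤q^d = ≤-pred (toℕ<n j)
      in  suc (toℕ i) , toℕ j ∸ toℕ i ,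
          (s<s z≤n , ≤-trans i<j j≤q^d) ,
          (m<n⇒0<n∸m i<j , ≤-trans (m∸n≤m (toℕ j) (toℕ i)) j≤q^d) ,
          residueWindow-≡⇒WindowsAgree (trans code≡
            (cong (λ k → funToFin (residueWindow (suc k))) (sym (m+[n∸m]≡n (<⇒≤ i<j)))))

-- Matching q = suc _ lets modℕ reduce to %ℕ.
lemma2p1 : (d : ℕ) → 1 ≤ d → (a : ℕ → ℤ) → (b : ℤ) → a 0 ≢ 0ℤ →
    (R : ℕ → ℤ) →
    (∀ n → 1 ≤ n → R (n Data.Nat.+ d) ≡ sumBelow d (λ i → a i * R (n Data.Nat.+ i)) + b) →
    (q : ℕ) → 2 ≤ q →
    Σ ℕ λ s → Σ ℕ λ L →
      (1 ≤ s × s ≤ q ^ d) × (1 ≤ L × L ≤ q ^ d) ×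
      (∀ n → s ≤ n → R n modℕ q ≡ R (n Data.Nat.+ L) modℕ q) ×
      (Coprime ∣ a 0 ∣ q → s ≡ 1) ×
      (Prime q → s ≤ ∣ a 0 ∣ ^ d)
lemma2p1 d 1≤d a b a₀≢0 R rec q@(suc _) _ =
  let s , L , (1≤s , s≤q^d) , L-bounds , window≡ = repeated-window in
  case coprime? ∣ a 0 ∣ q of λ where
    (yes a₀⊥q) → 1 , L , (≤-refl , m^n>0 q d) , L-bounds ,
                 periodic ≤-refl (WindowsAgree-from-1 a₀⊥q 1≤s window≡) ,
                 (λ _ → refl) , (λ _ → m^n>0 ∣ a 0 ∣ d)
    (no ¬a₀⊥q) → s , L , (1≤s , s≤q^d) , L-bounds , periodic 1≤s window≡ ,
                 (λ a₀⊥q → contradiction a₀⊥q ¬a₀⊥q) ,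
                 (λ q-prime → ≤-trans s≤q^d
                    (^-monoˡ-≤ d (ℕ∣.∣⇒≤ (¬coprime⇒prime∣ q-prime ¬a₀⊥q))))
  where
  instance
    d≢0 : NonZero d
    d≢0 = ℕ.>-nonZero 1≤d
    ∣a₀∣≢0 : NonZero ∣ a 0 ∣
    ∣a₀∣≢0 = ℕ.≢-nonZero (a₀≢0 ∘ ∣i∣≡0⇒i≡0)
  open LinearRecurrence d a b R rec q
  periodic : ∀ {s L} → 1 ≤ s → WindowsAgree s (s ℕ.+ L) →
             ∀ n → s ≤ n → R n %ℕ q ≡ R (n ℕ.+ L) %ℕ q
  periodic 1≤s window≡ n s≤n = ≡-mod⇒%ℕ-≡ (WindowsAgree⇒periodic 1≤s window≡ n s≤n)
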